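{- Let $a\geqslant 2$, $b\geqslant 0$ be integers, and let $\pi\in\mathfrak{S}_n$ with $\pi\in\mathrm{Av}(\sigma_{a,b})$. If the longest decreasing subsequence of $\pi$ has length $m$, then $S(\pi)$ does not contain $\delta_{m+1}$.
   Context: Permutations are written in one-line notation $\pi=\pi_1\ldots\pi_n$; $\mathfrak{S}_n$ is the set of permutations of size $n$. A permutation $\pi$ contains a pattern $\rho$ of size $k$ if some subsequence $\pi_{i_1}\ldots\pi_{i_k}$ ($i_1<\dots<i_k$) is order-isomorphic to $\rho$ (an occurrence); in it, $\pi_{i_j}$ plays the role of the value $\rho_j$. $\pi$ avoids $\rho$ if it does not contain it; $\mathrm{Av}(\Pi)$ is the set of all permutations avoiding every pattern in the set $\Pi$. $[x,y]$ is the set of integers between $x$ and $y$ inclusive; $\iota_k=12\ldots k$ and $\delta_k=k(k-1)\ldots1$. For integers $c\geqslant1,d\geqslant0$ with $c+d\geqslant 2$, the partial shuffle $\Pi(c,d)$ is the set of permutations of size $c+d$ obtained by writing $[c+d]\setminus\{c\}$ in increasing order and inserting $c$ in every position except the one giving $\iota_{c+d}$. Fix $a\geqslant 2$, $b\geqslant 0$. $\sigma_{a,b}$ is the permutation obtained from $\iota_{a+b}$ by transposing the entries $a-1$ and $a$. If $\pi$ contains a pattern from $\Pi(a-1,b+1)$, $\underline{a}$ is the smallest value of an entry of $\pi$ playing the role of $a$ in some occurrence of a pattern from $\Pi(a-1,b+1)$; an entry is an $a-1$ element associated with $\underline{a}$ if it plays the role of $a-1$ in an occurrence of a pattern from $\Pi(a-1,b+1)$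 in which the entry of value $\underline{a}$ plays the role of $a$; $\underline{a-1}$ is the smallest value of such an entry. The map $S:\mathfrak{S}_n\to\mathfrak{S}_n$ (depending on $a,b$) is defined by: $S(\pi)=\pi$ if $\pi$ avoids every pattern of $\Pi(a-1,b+1)$; otherwise $S(\pi)_i=\pi_i+1$ if $\pi_i\in[\underline{a-1},\underline{a}-1]$, $S(\pi)_i=\underline{a-1}$ if $\pi_i=\underline{a}$, and $S(\pi)_i=\pi_i$ otherwise. -}

module Defs where

open import Data.Nat using (ℕ; zero; suc; _+_; _∸_; _≤_; _<_; _≤?_; _<?_; _≟_)
open import Data.Fin using (Fin; toℕ)
import Data.Fin as F
open import Data.Fin.Permutation using (Permutation′; _⟨$⟩ʳ_)
open import Data.Product using (Σ; ∃; _×_; _,_)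
open import Relation.Nullary using (¬_; yes; no)
open import Relation.Binary.PropositionalEquality using (_≡_)

Word : ℕ → Set
Word n = Fin n → ℕ

-- One-line notation of a permutation of Fin n (values 0..n-1; only the
-- relative order matters for everything below).
word : ∀ {n} → Permutation′ n → Word n
word π i = toℕ (π ⟨$⟩ʳ i)

OrderIso : ∀ {k} → Word k → Word k → Set
OrderIso u v = ∀ i j → (u i < u j → v i < v j) × (v i < v j → u i < u j)

Occurrence : ∀ {n k} → Word n → Word k → Set
Occurrence {n} {k} w ρ =
  Σ (Fin k → Fin n) λ f →
    (∀ i j → i F.< j → f i F.< f j) × OrderIso ρ (λ i → w (f i))

Contains : ∀ {n k} → Word n → Word k → Set
Contains w ρ = Occurrence w ρ

Avoids : ∀ {n k} → Word n → Word k → Set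
Avoids w ρ = ¬ Contains w ρ

δ : (k : ℕ) → Word k
δ k i = k ∸ toℕ i

-- σ_{a,b}: ι_{a+b} with the values a-1 and a transposed (1-indexed values).
σ : (a b : ℕ) → Word (a + b)
σ a b i with toℕ i ≟ a ∸ 2
... | yes _ = a
... | no _ with toℕ i ≟ a ∸ 1
...   | yes _ = a ∸ 1
...   | no _ = suc (toℕ i)

-- Partial shuffle element: the values [c+d] \ {c} in increasing order,
-- with c inserted at (0-indexed) position p.  (1-indexed values.)
-- The element of Π(c,d) are exactly  shuffle c d p  for p < c+d, p ≢ c-1.
skipC : ℕ → ℕ → ℕ
skipC c j with suc j <? c
... | yes _ = suc j
... | no _ = suc (suc j)

shuffle : (c d p : ℕ) → Word (c + d)
shuffle c d p i with toℕ i <? p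
... | yes _ = skipC c (toℕ i)
... | no _ with toℕ i ≟ p
...   | yes _ = c
...   | no _ = skipC c (toℕ i ∸ 1)

-- Valid insertion positions for Π(c,d): p ∈ [0, c+d-1], p ≠ c-1
-- (position c-1 would give ι_{c+d}).
ValidPos : (c d p : ℕ) → Set
ValidPos c d p = (p < c + d) × ¬ (p ≡ c ∸ 1)

ContainsΠ : ∀ {n} → (c d : ℕ) → Word n → Set
ContainsΠ c d w = ∃ λ p → ValidPos c d p × Contains w (shuffle c d p)

PlaysA : ∀ {n} → (a b : ℕ) → Word n → ℕ → Set
PlaysA a b w x =
  ∃ λ p → ValidPos (a ∸ 1) (suc b) p ×
    Σ (Occurrence w (shuffle (a ∸ 1) (suc b) p)) λ { (f , _) →
      ∃ λ j → shuffle (a ∸ 1) (suc b) p j ≡ a × w (f j) ≡ x }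

AssocA1 : ∀ {n} → (a b : ℕ) → Word n → ℕ → ℕ → Set
AssocA1 a b w A y =
  ∃ λ p → ValidPos (a ∸ 1) (suc b) p ×
    Σ (Occurrence w (shuffle (a ∸ 1) (suc b) p)) λ { (f , _) →
      ∃ λ j → ∃ λ j′ →
        shuffle (a ∸ 1) (suc b) p j ≡ a × w (f j) ≡ A ×
        shuffle (a ∸ 1) (suc b) p j′ ≡ a ∸ 1 × w (f j′) ≡ y }

IsUnderA : ∀ {n} → (a b : ℕ) → Word n → ℕ → Set
IsUnderA a b w A = PlaysA a b w A × (∀ x → PlaysA a b w x → A ≤ x)

IsUnderA1 : ∀ {n} → (a b : ℕ) → Word n → ℕ → ℕ → Set
IsUnderA1 a b w A A1 = AssocA1 a b w A A1 × (∀ y → AssocA1 a b w A y → A1 ≤ y)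

shiftVal : ℕ → ℕ → ℕ → ℕ
shiftVal A A1 v with A1 ≤? v | v <? A
... | yes _ | yes _ = suc v
... | _ | _ with v ≟ A
...   | yes _ = A1
...   | no _ = v

data IsS {n : ℕ} (a b : ℕ) (w : Word n) (τ : Word n) : Set where
  s-avoid : ¬ ContainsΠ (a ∸ 1) (suc b) w → (∀ i → τ i ≡ w i) → IsS a b w τ
  s-move  : (A A1 : ℕ) → IsUnderA a b w A → IsUnderA1 a b w A A1 →
            (∀ i → τ i ≡ shiftVal A A1 (w i)) → IsS a b w τ

LongestDecreasing : ∀ {n} → Word n → ℕ → Set
LongestDecreasing w m = Contains w (δ m) × Avoids w (δ (suc m))

-- Let A and A1 be the values of the entries playing a and a-1 in an occurrence of a pattern of
-- Π(a-1,b+1) chosen with A minimal and then A1 minimal.  S keeps the relative order of all entries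
-- except the one of value A, which drops to A1.  So a decreasing subsequence of S(π) missing that
-- entry is one of π; if it passes through it, the earlier entries are at least A1 and the later
-- ones below A1, and that entry can be exchanged for one of π: the (a-1)-entry when a = 2, the
-- a-entry when all earlier entries exceed A, and otherwise the entry playing a-2.  Whenever the
-- exchange fails, moving one entry of the occurrence gives an occurrence with a smaller A, or with
-- the same A and a smaller A1.

module Submission where

open import Defs
open import Data.Nat using (ℕ; zero; suc; pred; _+_; _∸_; _≤_; _<_; _≤?_; _<?_; _≟_; z≤n; s≤s; z<s)
open import Data.Nat.Properties
open import Data.Fin using (Fin; toℕ; fromℕ<; fromℕ)
import Data.Fin as F
import Data.Fin.Properties as FP
open import Data.Fin.Permutation using (Permutation′)
open import Data.Product using (Σ; ∃; _×_; _,_; proj₁; proj₂)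
open import Data.Sum using (inj₁; inj₂)
open import Data.Empty using (⊥; ⊥-elim)
open import Function using (_∘_; Injection)
open import Function.Properties.Inverse using (↔⇒↣)
open import Data.Vec.Functional using (updateAt)
open import Data.Vec.Functional.Properties using (updateAt-updates; updateAt-minimal)
open import Relation.Nullary using (yes; no; contradiction)
open import Relation.Nullary.Decidable using (_×-dec_)
open import Relation.Binary.PropositionalEquality
open import Relation.Binary.Definitions using (tri<; tri≈; tri>)

-- Inserting one value into a sequence

punchInℕ : ℕ → ℕ → ℕ
punchInℕ p i with i <? p
... | yes _ = i
... | no _ = suc i

insertAt : {X : Set} → ℕ → (ℕ → X) → X → ℕ → X
insertAt p r x k with k <? p
... | yes _ = r k
... | no _ with k ≟ p
...   | yes _ = x
...   | no _ = r (k ∸ 1)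

map-insertAt : {X Y : Set} (h : X → Y) (p : ℕ) (r : ℕ → X) (x : X) (k : ℕ) →
               h (insertAt p r x k) ≡ insertAt p (h ∘ r) (h x) k
map-insertAt h p r x k with k <? p
... | yes _ = refl
... | no _ with k ≟ p
...   | yes _ = refl
...   | no _ = refl

insertAt-< : {X : Set} {p : ℕ} (r : ℕ → X) (x : X) {k : ℕ} → k < p → insertAt p r x k ≡ r k
insertAt-< {p = p} r x {k} k<p with k <? p
... | yes _ = refl
... | no k≮p = contradiction k<p k≮p

insertAt-≡ : {X : Set} (p : ℕ) (r : ℕ → X) (x : X) → insertAt p r x p ≡ x
insertAt-≡ p r x with p <? p
... | yes p<p = contradiction p<p (n≮n p)
... | no _ with p ≟ p
...   | yes _ = refl
...   | no p≢p = contradiction refl p≢p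

insertAt-> : {X : Set} {p : ℕ} (r : ℕ → X) (x : X) {k : ℕ} → p < k → insertAt p r x k ≡ r (k ∸ 1)
insertAt-> {p = p} r x {k} p<k with k <? p
... | yes k<p = contradiction k<p (<⇒≯ p<k)
... | no _ with k ≟ p
...   | yes k≡p = contradiction (sym k≡p) (<⇒≢ p<k)
...   | no _ = refl

punchInℕ-< : ∀ {p i} → i < p → punchInℕ p i ≡ i
punchInℕ-< {p} {i} i<p with i <? p
... | yes _ = refl
... | no i≮p = contradiction i<p i≮p

punchInℕ-≥ : ∀ {p i} → p ≤ i → punchInℕ p i ≡ suc i
punchInℕ-≥ {p} {i} p≤i with i <? p
... | yes i<p = contradiction p≤i (<⇒≱ i<p)
... | no _ = refl

punchInℕ-≤ : ∀ p i → punchInℕ p i ≤ suc i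
punchInℕ-≤ p i with i <? p
... | yes _ = n≤1+n i
... | no _ = ≤-refl

insertAt-punchInℕ : {X : Set} (p : ℕ) (r : ℕ → X) (x : X) (i : ℕ) →
                    insertAt p r x (punchInℕ p i) ≡ r i
insertAt-punchInℕ p r x i with i <? p
... | yes i<p = insertAt-< r x i<p
... | no i≮p = insertAt-> r x (s≤s (≮⇒≥ i≮p))

insertAt-punchInℕ-id : ∀ p k → insertAt p (punchInℕ p) p k ≡ k
insertAt-punchInℕ-id p k with <-cmp k p
... | tri< k<p _ _ = trans (insertAt-< (punchInℕ p) p k<p) (punchInℕ-< k<p)
... | tri≈ _ refl _ = insertAt-≡ p (punchInℕ p) p
... | tri> _ _ p<k = trans (insertAt-> (punchInℕ p) p p<k) (punchInℕ-pred p<k)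
  where
  punchInℕ-pred : ∀ {p k} → p < k → punchInℕ p (k ∸ 1) ≡ k
  punchInℕ-pred {k = suc k} (s≤s p≤k) = punchInℕ-≥ p≤k

-- Increasing sequences cut by a value

Increasing : (ℕ → ℕ) → ℕ → Set
Increasing R L = ∀ i j → i < j → j < L → R i < R j

SplitsAt : (ℕ → ℕ) → ℕ → ℕ → ℕ → Set
SplitsAt R x θ L = ∀ i → i < L → (i < θ → R i < x) × (θ ≤ i → x < R i)

Increasing-≤ : ∀ {R L i j} → Increasing R L → i ≤ j → j < L → R i ≤ R j
Increasing-≤ {i = i} {j} inc i≤j j<L with m≤n⇒m<n∨m≡n i≤j
... | inj₁ i<j = <⇒≤ (inc i j i<j j<L)
... | inj₂ refl = ≤-refl

Increasing-reflects-< : ∀ {R L i j} → Increasing R L → i < L → j < L → R i < R j → i < j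
Increasing-reflects-< {i = i} {j} inc i<L j<L Ri<Rj with <-cmp i j
... | tri< i<j _ _ = i<j
... | tri≈ _ refl _ = contradiction Ri<Rj (n≮n _)
... | tri> _ _ j<i = contradiction Ri<Rj (<⇒≯ (inc j i j<i i<L))

SplitsAt-below⁻ : ∀ {R x θ L i} → SplitsAt R x θ L → i < L → R i < x → i < θ
SplitsAt-below⁻ {θ = θ} {i = i} split i<L Ri<x with i <? θ
... | yes i<θ = i<θ
... | no i≮θ = contradiction Ri<x (<⇒≯ (proj₂ (split i i<L) (≮⇒≥ i≮θ)))

SplitsAt-above⁻ : ∀ {R x θ L i} → SplitsAt R x θ L → i < L → x < R i → θ ≤ i
SplitsAt-above⁻ {θ = θ} {i = i} split i<L x<Ri with i <? θ
... | yes i<θ = contradiction x<Ri (<⇒≯ (proj₁ (split i i<L) i<θ))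
... | no i≮θ = ≮⇒≥ i≮θ

SplitsAt-exists : ∀ (R : ℕ → ℕ) (L x : ℕ) → Increasing R L → (∀ i → i < L → R i ≢ x) →
                  ∃ λ θ → θ ≤ L × SplitsAt R x θ L
SplitsAt-exists R zero x inc ≢x = 0 , z≤n , λ i ()
SplitsAt-exists R (suc L) x inc ≢x
  with SplitsAt-exists R L x (λ i j i<j j<L → inc i j i<j (m<n⇒m<1+n j<L))
                             (λ i i<L → ≢x i (m<n⇒m<1+n i<L))
... | θ , θ≤L , split with <-cmp x (R L)
...   | tri≈ _ x≡RL _ = contradiction (sym x≡RL) (≢x L (n<1+n L))
...   | tri< x<RL _ _ = θ , m≤n⇒m≤1+n θ≤L , split′
  where
  split′ : SplitsAt R x θ (suc L)
  split′ i i<1+L with m≤n⇒m<n∨m≡n (≤-pred i<1+L)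
  ... | inj₁ i<L = split i i<L
  ... | inj₂ refl = (λ L<θ → contradiction θ≤L (<⇒≱ L<θ)) , (λ _ → x<RL)
...   | tri> _ _ RL<x = suc L , ≤-refl , split′
  where
  split′ : SplitsAt R x (suc L) (suc L)
  split′ i i<1+L = (λ _ → ≤-<-trans (Increasing-≤ inc (≤-pred i<1+L) (n<1+n L)) RL<x)
                 , (λ 1+L≤i → contradiction i<1+L (≤⇒≯ 1+L≤i))

punchInℕ-increasing : ∀ p L → Increasing (punchInℕ p) L
punchInℕ-increasing p L i j i<j _ with i <? p | j <? p
... | yes _ | yes _ = i<j
... | yes _ | no _ = m<n⇒m<1+n i<j
... | no i≮p | yes j<p = contradiction (<-trans i<j j<p) i≮p
... | no _ | no _ = s≤s i<j

punchInℕ-splitsAt : ∀ p L → SplitsAt (punchInℕ p) p p L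
punchInℕ-splitsAt p L i _ = (λ i<p → subst (_< p) (sym (punchInℕ-< i<p)) i<p)
                          , (λ p≤i → subst (p <_) (sym (punchInℕ-≥ p≤i)) (s≤s p≤i))

SplitsAt-≢ : ∀ {R x θ L i} → SplitsAt R x θ L → i < L → R i ≢ x
SplitsAt-≢ {θ = θ} {i = i} split i<L with i <? θ
... | yes i<θ = <⇒≢ (proj₁ (split i i<L) i<θ)
... | no i≮θ = ≢-sym (<⇒≢ (proj₂ (split i i<L) (≮⇒≥ i≮θ)))

updateAtℕ : {X : Set} → (ℕ → X) → ℕ → X → ℕ → X
updateAtℕ g k x i with i ≟ k
... | yes _ = x
... | no _ = g i

updateAtℕ-updates : {X : Set} (g : ℕ → X) (k : ℕ) (x : X) → updateAtℕ g k x k ≡ x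
updateAtℕ-updates g k x with k ≟ k
... | yes _ = refl
... | no k≢k = contradiction refl k≢k

module _ {X : Set} (F : X → ℕ) {g : ℕ → X} {k : ℕ} {x : X} {L : ℕ} where

  Increasing-updateAtℕ : Increasing (F ∘ g) L →
    (∀ i → i < k → F (g i) < F x) → (∀ j → k < j → j < L → F x < F (g j)) →
    Increasing (F ∘ updateAtℕ g k x) L
  Increasing-updateAtℕ inc lower upper i j i<j j<L with i ≟ k | j ≟ k
  ... | yes refl | yes refl = contradiction i<j (n≮n _)
  ... | yes refl | no _ = upper j i<j j<L
  ... | no _ | yes refl = lower i i<j
  ... | no _ | no _ = inc i j i<j j<L

  SplitsAt-updateAtℕ : ∀ {z θ} → SplitsAt (F ∘ g) z θ L → (k < θ → F x < z) × (θ ≤ k → z < F x) →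
    SplitsAt (F ∘ updateAtℕ g k x) z θ L
  SplitsAt-updateAtℕ split x-side i i<L with i ≟ k
  ... | yes refl = x-side
  ... | no _ = split i i<L

module _ {p L : ℕ} (p≤L : p ≤ L) where

  private
    below : ∀ {i} → i < p → i < L
    below i<p = <-≤-trans i<p p≤L

    above : ∀ {i} → p < i → i ≤ L → i ∸ 1 < L
    above {suc i} _ i<L = i<L

  -- The relative order of the entries of  insertAt p R x  depends only on p and on the index θ at which x splits R.
  insertAt-<-transport : ∀ {θ R x R′ x′ k k′} →
    Increasing R L → SplitsAt R x θ L → Increasing R′ L → SplitsAt R′ x′ θ L → k ≤ L → k′ ≤ L →
    insertAt p R x k < insertAt p R x k′ → insertAt p R′ x′ k < insertAt p R′ x′ k′
  insertAt-<-transport {θ} {R} {x} {R′} {x′} {k} {k′} inc split inc′ split′ k≤L k′≤L lt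
    with <-cmp k p | <-cmp k′ p
  ... | tri< k<p _ _ | tri< k′<p _ _
    rewrite insertAt-< R x k<p | insertAt-< R x k′<p | insertAt-< R′ x′ k<p | insertAt-< R′ x′ k′<p =
      inc′ k k′ (Increasing-reflects-< inc (below k<p) (below k′<p) lt) (below k′<p)
  ... | tri< k<p _ _ | tri≈ _ refl _
    rewrite insertAt-< R x k<p | insertAt-≡ p R x | insertAt-< R′ x′ k<p | insertAt-≡ p R′ x′ =
      proj₁ (split′ k (below k<p)) (SplitsAt-below⁻ split (below k<p) lt)
  ... | tri< k<p _ _ | tri> _ _ p<k′
    rewrite insertAt-< R x k<p | insertAt-> R x p<k′ | insertAt-< R′ x′ k<p | insertAt-> R′ x′ p<k′ =
      inc′ k (k′ ∸ 1) (Increasing-reflects-< inc (below k<p) (above p<k′ k′≤L) lt) (above p<k′ k′≤L)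
  ... | tri≈ _ refl _ | tri< k′<p _ _
    rewrite insertAt-< R x k′<p | insertAt-≡ p R x | insertAt-< R′ x′ k′<p | insertAt-≡ p R′ x′ =
      proj₂ (split′ k′ (below k′<p)) (SplitsAt-above⁻ split (below k′<p) lt)
  ... | tri≈ _ refl _ | tri≈ _ refl _ = contradiction lt (n≮n _)
  ... | tri≈ _ refl _ | tri> _ _ p<k′
    rewrite insertAt-> R x p<k′ | insertAt-≡ p R x | insertAt-> R′ x′ p<k′ | insertAt-≡ p R′ x′ =
      proj₂ (split′ (k′ ∸ 1) (above p<k′ k′≤L)) (SplitsAt-above⁻ split (above p<k′ k′≤L) lt)
  ... | tri> _ _ p<k | tri< k′<p _ _
    rewrite insertAt-> R x p<k | insertAt-< R x k′<p | insertAt-> R′ x′ p<k | insertAt-< R′ x′ k′<p =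
      inc′ (k ∸ 1) k′ (Increasing-reflects-< inc (above p<k k≤L) (below k′<p) lt) (below k′<p)
  ... | tri> _ _ p<k | tri≈ _ refl _
    rewrite insertAt-> R x p<k | insertAt-≡ p R x | insertAt-> R′ x′ p<k | insertAt-≡ p R′ x′ =
      proj₁ (split′ (k ∸ 1) (above p<k k≤L)) (SplitsAt-below⁻ split (above p<k k≤L) lt)
  ... | tri> _ _ p<k | tri> _ _ p<k′
    rewrite insertAt-> R x p<k | insertAt-> R x p<k′ | insertAt-> R′ x′ p<k | insertAt-> R′ x′ p<k′ =
      inc′ (k ∸ 1) (k′ ∸ 1) (Increasing-reflects-< inc (above p<k k≤L) (above p<k′ k′≤L) lt) (above p<k′ k′≤L)

skipC-< : ∀ {a′ i} → i < a′ → skipC (suc a′) i ≡ suc i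
skipC-< {a′} {i} i<a′ with suc i <? suc a′
... | yes _ = refl
... | no i≮a′ = contradiction (s≤s i<a′) i≮a′

skipC-≥ : ∀ {a′ i} → a′ ≤ i → skipC (suc a′) i ≡ suc (suc i)
skipC-≥ {a′} {i} a′≤i with suc i <? suc a′
... | yes i<a′ = contradiction a′≤i (<⇒≱ (≤-pred i<a′))
... | no _ = refl

skipC-increasing : ∀ a′ L → Increasing (skipC (suc a′)) L
skipC-increasing a′ L i j i<j _ with i <? a′ | j <? a′
... | yes i<a′ | yes j<a′ rewrite skipC-< i<a′ | skipC-< j<a′ = s≤s i<j
... | yes i<a′ | no j≮a′ rewrite skipC-< i<a′ | skipC-≥ (≮⇒≥ j≮a′) = s≤s (m<n⇒m<1+n i<j)
... | no i≮a′ | yes j<a′ = contradiction (<-trans i<j j<a′) i≮a′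
... | no i≮a′ | no j≮a′ rewrite skipC-≥ (≮⇒≥ i≮a′) | skipC-≥ (≮⇒≥ j≮a′) = s≤s (s≤s i<j)

skipC-splitsAt : ∀ a′ L → SplitsAt (skipC (suc a′)) (suc a′) a′ L
skipC-splitsAt a′ L i _ = (λ i<a′ → subst (_< suc a′) (sym (skipC-< i<a′)) (s≤s i<a′))
                        , (λ a′≤i → subst (suc a′ <_) (sym (skipC-≥ a′≤i)) (s≤s (s≤s a′≤i)))

skipC-≡-suc⁻ : ∀ {a′ r} → skipC (suc a′) r ≡ suc (suc a′) → r ≡ a′
skipC-≡-suc⁻ {a′} {r} eq with r <? a′
... | yes r<a′ rewrite skipC-< r<a′ = contradiction (suc-injective eq) (<⇒≢ (m<n⇒m<1+n r<a′))
... | no r≮a′ rewrite skipC-≥ (≮⇒≥ r≮a′) = suc-injective (suc-injective eq)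

skipC-≢ : ∀ {a′ r} → skipC (suc a′) r ≢ suc a′
skipC-≢ {a′} {r} eq with r <? a′
... | yes r<a′ rewrite skipC-< r<a′ = <⇒≢ r<a′ (suc-injective eq)
... | no r≮a′ rewrite skipC-≥ (≮⇒≥ r≮a′) = <⇒≢ (s≤s (≮⇒≥ r≮a′)) (sym (suc-injective eq))

shuffle-insertAt : (c d p : ℕ) (k : Fin (c + d)) → shuffle c d p k ≡ insertAt p (skipC c) c (toℕ k)
shuffle-insertAt c d p k with toℕ k <? p
... | yes _ = refl
... | no _ with toℕ k ≟ p
...   | yes _ = refl
...   | no _ = refl

fromℕ-clamped : ∀ {K} → ℕ → Fin (suc K)
fromℕ-clamped {K} i with i ≤? K
... | yes i≤K = fromℕ< (s≤s i≤K)
... | no _ = fromℕ K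

toℕ-fromℕ-clamped : ∀ {K i} → i ≤ K → toℕ (fromℕ-clamped {K} i) ≡ i
toℕ-fromℕ-clamped {K} {i} i≤K with i ≤? K
... | yes i≤K = FP.toℕ-fromℕ< (s≤s i≤K)
... | no i≰K = contradiction i≤K i≰K

insertAt-skipC-≡-a⁻ : ∀ {p a′} k → insertAt p (skipC (suc a′)) (suc a′) k ≡ suc (suc a′) → k ≡ punchInℕ p a′
insertAt-skipC-≡-a⁻ {p} {a′} k eq with <-cmp k p
... | tri< k<p _ _ rewrite insertAt-< (skipC (suc a′)) (suc a′) k<p with skipC-≡-suc⁻ eq
...   | refl = sym (punchInℕ-< k<p)
insertAt-skipC-≡-a⁻ {p} {a′} k eq | tri≈ _ refl _ rewrite insertAt-≡ p (skipC (suc a′)) (suc a′) =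
  contradiction eq (<⇒≢ (n<1+n (suc a′)))
insertAt-skipC-≡-a⁻ {p} {a′} (suc k) eq | tri> _ _ (s≤s p≤k)
  rewrite insertAt-> (skipC (suc a′)) (suc a′) (s≤s p≤k) with skipC-≡-suc⁻ eq
... | refl = sym (punchInℕ-≥ p≤k)

insertAt-skipC-≡-a-1⁻ : ∀ {p a′} k → insertAt p (skipC (suc a′)) (suc a′) k ≡ suc a′ → k ≡ p
insertAt-skipC-≡-a-1⁻ {p} {a′} k eq with <-cmp k p
... | tri< k<p _ _ rewrite insertAt-< (skipC (suc a′)) (suc a′) k<p = contradiction eq skipC-≢
... | tri≈ _ k≡p _ = k≡p
... | tri> _ _ p<k rewrite insertAt-> (skipC (suc a′)) (suc a′) p<k = contradiction eq skipC-≢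

-- An occurrence in w of a pattern of Π(a′+1, b+1).  Without the entry s playing a′+1, its entries
-- g 0, …, g (a′ + b) increase in position and in value; s sits at positional index p (p ≢ a′ excludes ι)
-- and at value index a′ among them, so that g a′ plays a′+2.
record ΠOccurrence {n : ℕ} (a′ b : ℕ) (w : Word n) : Set where
  field
    p : ℕ
    p≤L : p ≤ a′ + suc b
    p≢a′ : p ≢ a′
    g : ℕ → Fin n
    s : Fin n
    pos-increasing : Increasing (toℕ ∘ g) (a′ + suc b)
    pos-splitsAt : SplitsAt (toℕ ∘ g) (toℕ s) p (a′ + suc b)
    val-increasing : Increasing (w ∘ g) (a′ + suc b)
    val-splitsAt : SplitsAt (w ∘ g) (w s) a′ (a′ + suc b)

  a-entry : Fin n
  a-entry = g a′

module _ {n a′ b : ℕ} {w : Word n} where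

  ΠOccurrence⇒AssocA1 : (O : ΠOccurrence a′ b w) →
    AssocA1 (suc (suc a′)) b w (w (ΠOccurrence.a-entry O)) (w (ΠOccurrence.s O))
  ΠOccurrence⇒AssocA1 O = p , (s≤s p≤L , p≢a′) , (f , f-increasing , f-orderIso)
                        , fromℕ-clamped (punchInℕ p a′) , fromℕ-clamped p
                        , role-a , value-a , role-a-1 , value-a-1
    where
    open ΠOccurrence O
    L = a′ + suc b
    f : Fin (suc L) → Fin n
    f k = insertAt p g s (toℕ k)
    index≤L : (k : Fin (suc L)) → toℕ k ≤ L
    index≤L k = ≤-pred (FP.toℕ<n k)
    f-increasing : ∀ i j → i F.< j → f i F.< f j
    f-increasing i j i<j rewrite map-insertAt toℕ p g s (toℕ i) | map-insertAt toℕ p g s (toℕ j) =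
      insertAt-<-transport p≤L {R = punchInℕ p} {x = p} (punchInℕ-increasing p L) (punchInℕ-splitsAt p L)
        pos-increasing pos-splitsAt (index≤L i) (index≤L j)
        (subst₂ _<_ (sym (insertAt-punchInℕ-id p (toℕ i))) (sym (insertAt-punchInℕ-id p (toℕ j))) i<j)
    f-orderIso : OrderIso (shuffle (suc a′) (suc b) p) (w ∘ f)
    f-orderIso i j rewrite shuffle-insertAt (suc a′) (suc b) p i | shuffle-insertAt (suc a′) (suc b) p j
                         | map-insertAt w p g s (toℕ i) | map-insertAt w p g s (toℕ j) =
      insertAt-<-transport p≤L (skipC-increasing a′ L) (skipC-splitsAt a′ L) val-increasing val-splitsAt
        (index≤L i) (index≤L j) ,
      insertAt-<-transport p≤L val-increasing val-splitsAt (skipC-increasing a′ L) (skipC-splitsAt a′ L)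
        (index≤L i) (index≤L j)
    a-index≤L : punchInℕ p a′ ≤ L
    a-index≤L = ≤-trans (punchInℕ-≤ p a′) (m<m+n a′ z<s)
    role-a : shuffle (suc a′) (suc b) p (fromℕ-clamped (punchInℕ p a′)) ≡ suc (suc a′)
    role-a rewrite shuffle-insertAt (suc a′) (suc b) p (fromℕ-clamped {L} (punchInℕ p a′))
                 | toℕ-fromℕ-clamped {L} a-index≤L | insertAt-punchInℕ p (skipC (suc a′)) (suc a′) a′ = skipC-≥ ≤-refl
    value-a : w (f (fromℕ-clamped (punchInℕ p a′))) ≡ w (g a′)
    value-a rewrite toℕ-fromℕ-clamped {L} a-index≤L | insertAt-punchInℕ p g s a′ = refl
    role-a-1 : shuffle (suc a′) (suc b) p (fromℕ-clamped p) ≡ suc a′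
    role-a-1 rewrite shuffle-insertAt (suc a′) (suc b) p (fromℕ-clamped {L} p) | toℕ-fromℕ-clamped {L} p≤L =
      insertAt-≡ p _ _
    value-a-1 : w (f (fromℕ-clamped p)) ≡ w s
    value-a-1 rewrite toℕ-fromℕ-clamped {L} p≤L | insertAt-≡ p g s = refl

  ΠOccurrence⇒PlaysA : (O : ΠOccurrence a′ b w) → PlaysA (suc (suc a′)) b w (w (ΠOccurrence.a-entry O))
  ΠOccurrence⇒PlaysA O with ΠOccurrence⇒AssocA1 O
  ... | p , valid , occ , j , _ , role , value , _ = p , valid , occ , j , role , value

  AssocA1⇒ΠOccurrence : ∀ {A y} → AssocA1 (suc (suc a′)) b w A y →
    Σ (ΠOccurrence a′ b w) λ O → w (ΠOccurrence.a-entry O) ≡ A × w (ΠOccurrence.s O) ≡ y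
  AssocA1⇒ΠOccurrence (p , (p<1+L , p≢a′) , (f , f-increasing , f-orderIso) , j , j′ , role , value , role′ , value′) =
    O , trans (cong (w ∘ f) (sym a-index)) value , trans (cong (w ∘ f) (sym a-1-index)) value′
    where
    L = a′ + suc b
    p≤L = ≤-pred p<1+L
    g : ℕ → Fin n
    g i = f (fromℕ-clamped (punchInℕ p i))
    s : Fin n
    s = f (fromℕ-clamped p)
    index : ∀ {i} → i < L → toℕ (fromℕ-clamped {L} (punchInℕ p i)) ≡ punchInℕ p i
    index i<L = toℕ-fromℕ-clamped (≤-trans (punchInℕ-≤ p _) i<L)
    shuffle-g : ∀ {i} → i < L → shuffle (suc a′) (suc b) p (fromℕ-clamped (punchInℕ p i)) ≡ skipC (suc a′) i
    shuffle-g {i} i<L rewrite shuffle-insertAt (suc a′) (suc b) p (fromℕ-clamped {L} (punchInℕ p i)) | index i<L =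
      insertAt-punchInℕ p _ _ i
    shuffle-s : shuffle (suc a′) (suc b) p (fromℕ-clamped p) ≡ suc a′
    shuffle-s rewrite shuffle-insertAt (suc a′) (suc b) p (fromℕ-clamped {L} p) | toℕ-fromℕ-clamped {L} p≤L =
      insertAt-≡ p _ _
    a-index : j ≡ fromℕ-clamped (punchInℕ p a′)
    a-index = FP.toℕ-injective (trans (insertAt-skipC-≡-a⁻ (toℕ j) (trans (sym (shuffle-insertAt _ _ p j)) role))
                                      (sym (index (m<m+n a′ z<s))))
    a-1-index : j′ ≡ fromℕ-clamped p
    a-1-index = FP.toℕ-injective (trans (insertAt-skipC-≡-a-1⁻ (toℕ j′) (trans (sym (shuffle-insertAt _ _ p j′)) role′))
                                        (sym (toℕ-fromℕ-clamped p≤L)))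
    O : ΠOccurrence a′ b w
    O = record
      { p = p ; p≤L = p≤L ; p≢a′ = p≢a′ ; g = g ; s = s
      ; pos-increasing = λ i j i<j j<L → f-increasing _ _
          (subst₂ _<_ (sym (index (<-trans i<j j<L))) (sym (index j<L)) (punchInℕ-increasing p L i j i<j j<L))
      ; pos-splitsAt = λ i i<L →
          (λ i<p → f-increasing _ _ (subst₂ _<_ (sym (index i<L)) (sym (toℕ-fromℕ-clamped p≤L))
                                              (proj₁ (punchInℕ-splitsAt p L i i<L) i<p))) ,
          (λ p≤i → f-increasing _ _ (subst₂ _<_ (sym (toℕ-fromℕ-clamped p≤L)) (sym (index i<L))
                                              (proj₂ (punchInℕ-splitsAt p L i i<L) p≤i)))
      ; val-increasing = λ i j i<j j<L → proj₁ (f-orderIso _ _)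
          (subst₂ _<_ (sym (shuffle-g (<-trans i<j j<L))) (sym (shuffle-g j<L)) (skipC-increasing a′ L i j i<j j<L))
      ; val-splitsAt = λ i i<L →
          (λ i<a′ → proj₁ (f-orderIso _ _) (subst₂ _<_ (sym (shuffle-g i<L)) (sym shuffle-s)
                                                      (proj₁ (skipC-splitsAt a′ L i i<L) i<a′))) ,
          (λ a′≤i → proj₁ (f-orderIso _ _) (subst₂ _<_ (sym shuffle-s) (sym (shuffle-g i<L))
                                                      (proj₂ (skipC-splitsAt a′ L i i<L) a′≤i)))
      }

-- Decreasing subsequences

DecreasingSubsequence : ∀ {n k} → Word n → (Fin k → Fin n) → Set
DecreasingSubsequence w h = (∀ i j → i F.< j → h i F.< h j) × (∀ i j → i F.< j → w (h j) < w (h i))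

δ-decreasing : ∀ {k} (i j : Fin k) → toℕ i < toℕ j → δ k j < δ k i
δ-decreasing i j i<j = ∸-monoʳ-< i<j (<⇒≤ (FP.toℕ<n j))

δ-occurrence⇒decreasing : ∀ {n k} {w : Word n} → Occurrence w (δ k) → Σ (Fin k → Fin n) (DecreasingSubsequence w)
δ-occurrence⇒decreasing (h , h-increasing , orderIso) =
  h , h-increasing , λ i j i<j → proj₁ (orderIso j i) (δ-decreasing i j i<j)

decreasing⇒δ-occurrence : ∀ {n k} {w : Word n} (h : Fin k → Fin n) → DecreasingSubsequence w h → Occurrence w (δ k)
decreasing⇒δ-occurrence {k = k} {w} h (h-increasing , w∘h-decreasing) = h , h-increasing , orderIso
  where
  orderIso : OrderIso (δ k) (w ∘ h)
  orderIso i j with FP.<-cmp i j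
  ... | tri< i<j _ _ = (λ lt → contradiction lt (<⇒≯ (δ-decreasing i j i<j)))
                     , (λ lt → contradiction lt (<⇒≯ (w∘h-decreasing i j i<j)))
  ... | tri≈ _ refl _ = (λ lt → contradiction lt (n≮n _)) , (λ lt → contradiction lt (n≮n _))
  ... | tri> _ _ j<i = (λ _ → w∘h-decreasing j i j<i) , (λ _ → δ-decreasing j i j<i)

increasing-injective : ∀ {k n} {h : Fin k → Fin n} → (∀ i j → i F.< j → h i F.< h j) →
                       ∀ {i j} → h i ≡ h j → i ≡ j
increasing-injective increasing {i} {j} eq with FP.<-cmp i j
... | tri< i<j _ _ = contradiction (cong toℕ eq) (<⇒≢ (increasing i j i<j))
... | tri≈ _ i≡j _ = i≡j
... | tri> _ _ j<i = contradiction (cong toℕ (sym eq)) (<⇒≢ (increasing j i j<i))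

updateAt-decreasing : ∀ {n m} (w : Word n) (h : Fin m → Fin n) (t : Fin m) (z : Fin n) →
  (∀ i j → i F.< j → h i F.< h j) →
  (∀ i → i F.< t → h i F.< z × w z < w (h i)) →
  (∀ j → t F.< j → z F.< h j × w (h j) < w z) →
  (∀ i j → i F.< j → i ≢ t → j ≢ t → w (h j) < w (h i)) →
  DecreasingSubsequence w (updateAt h t (λ _ → z))
updateAt-decreasing w h t z h-increasing left right others = increasing , decreasing
  where
  h′ = updateAt h t (λ _ → z)
  at-t : h′ t ≡ z
  at-t = updateAt-updates t h
  off-t : ∀ {i} → i ≢ t → h′ i ≡ h i
  off-t i≢t = updateAt-minimal _ t h i≢t
  increasing : ∀ i j → i F.< j → h′ i F.< h′ j
  increasing i j i<j with i FP.≟ t | j FP.≟ t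
  ... | yes refl | yes refl = contradiction i<j (n≮n _)
  ... | yes refl | no j≢t rewrite at-t | off-t j≢t = proj₁ (right j i<j)
  ... | no i≢t | yes refl rewrite at-t | off-t i≢t = proj₁ (left i i<j)
  ... | no i≢t | no j≢t rewrite off-t i≢t | off-t j≢t = h-increasing i j i<j
  decreasing : ∀ i j → i F.< j → w (h′ j) < w (h′ i)
  decreasing i j i<j with i FP.≟ t | j FP.≟ t
  ... | yes refl | yes refl = contradiction i<j (n≮n _)
  ... | yes refl | no j≢t rewrite at-t | off-t j≢t = proj₂ (right j i<j)
  ... | no i≢t | yes refl rewrite at-t | off-t i≢t = proj₂ (left i i<j)
  ... | no i≢t | no j≢t rewrite off-t i≢t | off-t j≢t = others i j i<j i≢t j≢t

-- The value map of S

data Region (A A1 v : ℕ) : Set where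
  below  : v < A1 → Region A A1 v
  inside : A1 ≤ v → v < A → Region A A1 v
  above  : A < v → Region A A1 v

region : ∀ {A A1 v} → v ≢ A → Region A A1 v
region {A} {A1} {v} v≢A with A1 ≤? v | v <? A
... | no A1≰v | _ = below (≰⇒> A1≰v)
... | yes A1≤v | yes v<A = inside A1≤v v<A
... | yes _ | no v≮A = above (≤∧≢⇒< (≮⇒≥ v≮A) (v≢A ∘ sym))

shiftVal-A : ∀ A A1 → shiftVal A A1 A ≡ A1
shiftVal-A A A1 with A1 ≤? A | A <? A
... | _ | yes A<A = contradiction A<A (n≮n A)
... | yes _ | no _ with A ≟ A
...   | yes _ = refl
...   | no A≢A = contradiction refl A≢A
shiftVal-A A A1 | no _ | no _ with A ≟ A
...   | yes _ = refl
...   | no A≢A = contradiction refl A≢A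

shiftVal-below : ∀ {A A1 v} → v < A1 → v ≢ A → shiftVal A A1 v ≡ v
shiftVal-below {A} {A1} {v} v<A1 v≢A with A1 ≤? v
... | yes A1≤v = contradiction v<A1 (≤⇒≯ A1≤v)
... | no _ with v ≟ A
...   | yes v≡A = contradiction v≡A v≢A
...   | no _ = refl

shiftVal-inside : ∀ {A A1 v} → A1 ≤ v → v < A → shiftVal A A1 v ≡ suc v
shiftVal-inside {A} {A1} {v} A1≤v v<A with A1 ≤? v | v <? A
... | yes _ | yes _ = refl
... | no A1≰v | _ = contradiction A1≤v A1≰v
... | yes _ | no v≮A = contradiction v<A v≮A

shiftVal-above : ∀ {A A1 v} → A < v → shiftVal A A1 v ≡ v
shiftVal-above {A} {A1} {v} A<v with A1 ≤? v | v <? A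
... | _ | yes v<A = contradiction v<A (<⇒≯ A<v)
... | yes _ | no _ with v ≟ A
...   | yes v≡A = contradiction (sym v≡A) (<⇒≢ A<v)
...   | no _ = refl
shiftVal-above {A} {A1} {v} A<v | no _ | no _ with v ≟ A
...   | yes v≡A = contradiction (sym v≡A) (<⇒≢ A<v)
...   | no _ = refl

shiftVal-mono-< : ∀ {A A1 u v} → A1 ≤ A → u ≢ A → v ≢ A → u < v → shiftVal A A1 u < shiftVal A A1 v
shiftVal-mono-< {A} {A1} {u} {v} A1≤A u≢A v≢A u<v with region {A} {A1} u≢A | region {A} {A1} v≢A
... | below u<A1 | below v<A1
  rewrite shiftVal-below u<A1 u≢A | shiftVal-below v<A1 v≢A = u<v
... | below u<A1 | inside A1≤v v<A
  rewrite shiftVal-below u<A1 u≢A | shiftVal-inside A1≤v v<A = m<n⇒m<1+n u<v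
... | below u<A1 | above A<v
  rewrite shiftVal-below u<A1 u≢A | shiftVal-above {A1 = A1} A<v = u<v
... | inside A1≤u _ | below v<A1 = contradiction (≤-<-trans A1≤u u<v) (<⇒≯ v<A1)
... | inside A1≤u u<A | inside A1≤v v<A
  rewrite shiftVal-inside A1≤u u<A | shiftVal-inside A1≤v v<A = s≤s u<v
... | inside A1≤u u<A | above A<v
  rewrite shiftVal-inside A1≤u u<A | shiftVal-above {A1 = A1} A<v = ≤-<-trans u<A A<v
... | above A<u | below v<A1 = contradiction (<-trans (<-trans A<u u<v) v<A1) (≤⇒≯ A1≤A)
... | above A<u | inside _ v<A = contradiction (<-trans A<u u<v) (<⇒≯ v<A)
... | above A<u | above A<v
  rewrite shiftVal-above {A1 = A1} A<u | shiftVal-above {A1 = A1} A<v = u<v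

shiftVal-reflects-< : ∀ {A A1 u v} → A1 ≤ A → u ≢ A → v ≢ A → shiftVal A A1 u < shiftVal A A1 v → u < v
shiftVal-reflects-< {u = u} {v} A1≤A u≢A v≢A lt with <-cmp u v
... | tri< u<v _ _ = u<v
... | tri≈ _ refl _ = contradiction lt (n≮n _)
... | tri> _ _ v<u = contradiction lt (<⇒≯ (shiftVal-mono-< A1≤A v≢A u≢A v<u))

shiftVal-A1<⁻ : ∀ {A A1 v} → v ≢ A → A1 < shiftVal A A1 v → A1 ≤ v
shiftVal-A1<⁻ {A} {A1} {v} v≢A lt with region {A} {A1} v≢A
... | below v<A1 rewrite shiftVal-below v<A1 v≢A = contradiction lt (<⇒≯ v<A1)
... | inside A1≤v _ = A1≤v
... | above A<v rewrite shiftVal-above {A1 = A1} A<v = <⇒≤ lt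

shiftVal-<A1⁻ : ∀ {A A1 v} → A1 ≤ A → v ≢ A → shiftVal A A1 v < A1 → v < A1
shiftVal-<A1⁻ {A} {A1} {v} A1≤A v≢A lt with region {A} {A1} v≢A
... | below v<A1 = v<A1
... | inside A1≤v v<A rewrite shiftVal-inside A1≤v v<A = contradiction (<-trans (≤-<-trans A1≤v (n<1+n v)) lt) (n≮n A1)
... | above A<v rewrite shiftVal-above {A1 = A1} A<v = contradiction (≤-<-trans A1≤A A<v) (<⇒≯ lt)

-- An occurrence minimising the value of the a-entry, and then that of the (a-1)-entry

pred[n]<n : ∀ {k} → 0 < k → pred k < k
pred[n]<n {suc k} _ = ≤-refl

module MinimalOccurrence {n a′ b : ℕ} (w : Word n) (w-injective : ∀ {x y} → w x ≡ w y → x ≡ y)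
  (O : ΠOccurrence a′ b w)
  (a-minimal : (O′ : ΠOccurrence a′ b w) → w (ΠOccurrence.a-entry O) ≤ w (ΠOccurrence.a-entry O′))
  (a-1-minimal : (O′ : ΠOccurrence a′ b w) → w (ΠOccurrence.a-entry O′) ≡ w (ΠOccurrence.a-entry O) →
                 w (ΠOccurrence.s O) ≤ w (ΠOccurrence.s O′))
  where

  open ΠOccurrence O

  L = a′ + suc b
  q = a-entry
  A = w q
  A1 = w s

  a′<L : a′ < L
  a′<L = m<m+n a′ z<s

  A1<A : A1 < A
  A1<A = proj₂ (val-splitsAt a′ a′<L) ≤-refl

  no-smaller-a-1 : ∀ x → toℕ q < toℕ x → w x < A1 → (∀ i → i < a′ → w (g i) < w x) → ⊥
  no-smaller-a-1 x q<x x<A1 lower<x = contradiction (a-1-minimal O′ refl) (<⇒≱ x<A1)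
    where
    val-splitsAt′ : SplitsAt (w ∘ g) (w x) a′ L
    val-splitsAt′ i i<L = lower<x i , λ a′≤i → <-≤-trans (<-trans x<A1 A1<A) (Increasing-≤ val-increasing a′≤i i<L)
    slot : ∃ λ θ → θ ≤ L × SplitsAt (toℕ ∘ g) (toℕ x) θ L
    slot = SplitsAt-exists (toℕ ∘ g) L (toℕ x) pos-increasing
             (λ i i<L eq → SplitsAt-≢ val-splitsAt′ i<L (cong w (FP.toℕ-injective eq)))
    θ≢a′ : proj₁ slot ≢ a′
    θ≢a′ θ≡a′ = contradiction q<x (<⇒≯ (proj₂ (proj₂ (proj₂ slot) a′ a′<L) (≤-reflexive θ≡a′)))
    O′ : ΠOccurrence a′ b w
    O′ = record
      { p = proj₁ slot ; p≤L = proj₁ (proj₂ slot) ; p≢a′ = θ≢a′ ; g = g ; s = x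
      ; pos-increasing = pos-increasing ; pos-splitsAt = proj₂ (proj₂ slot)
      ; val-increasing = val-increasing ; val-splitsAt = val-splitsAt′ }

  module _ (0<a′ : 0 < a′) where

    G = g (pred a′)

    pred-a′<L : pred a′ < L
    pred-a′<L = <-trans (pred[n]<n 0<a′) a′<L

    G<A1 : w G < A1
    G<A1 = proj₁ (val-splitsAt (pred a′) pred-a′<L) (pred[n]<n 0<a′)

    G<q : toℕ G < toℕ q
    G<q = pos-increasing (pred a′) a′ (pred[n]<n 0<a′) a′<L

    -- s cannot sit between G and q, since p ≢ a′.
    s-beside : ∀ {x : Fin n} → toℕ G < toℕ x → toℕ x < toℕ q →
               (a′ < p → toℕ x < toℕ s) × (p ≤ a′ → toℕ s < toℕ x)
    s-beside G<x x<q = (λ a′<p → <-trans x<q (proj₁ (pos-splitsAt a′ a′<L) a′<p))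
                     , (λ p≤a′ → <-trans (proj₂ (pos-splitsAt (pred a′) pred-a′<L) (<⇒≤pred (≤∧≢⇒< p≤a′ p≢a′))) G<x)

    s-not-beside : ∀ {x : Fin n} → toℕ G < toℕ x → toℕ x < toℕ q → x ≢ s
    s-not-beside {x} G<x x<q refl with a′ <? p
    ... | yes a′<p = contradiction (proj₁ (s-beside G<x x<q) a′<p) (n≮n _)
    ... | no a′≮p = contradiction (proj₂ (s-beside G<x x<q) (≮⇒≥ a′≮p)) (n≮n _)

    no-smaller-a : ∀ x → toℕ G < toℕ x → toℕ x < toℕ q → A1 < w x → w x < A → ⊥
    no-smaller-a x G<x x<q A1<x x<A =
      contradiction (a-minimal O′) (<⇒≱ (subst (_< A) (sym (cong w (updateAtℕ-updates g a′ x))) x<A))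
      where
      g′ = updateAtℕ g a′ x
      below-a′ : ∀ {i} → i < a′ → i ≤ pred a′
      below-a′ = <⇒≤pred
      O′ : ΠOccurrence a′ b w
      O′ = record
        { p = p ; p≤L = p≤L ; p≢a′ = p≢a′ ; g = g′ ; s = s
        ; pos-increasing = Increasing-updateAtℕ toℕ pos-increasing
            (λ i i<a′ → ≤-<-trans (Increasing-≤ pos-increasing (below-a′ i<a′) pred-a′<L) G<x)
            (λ j a′<j j<L → <-trans x<q (pos-increasing a′ j a′<j j<L))
        ; pos-splitsAt = SplitsAt-updateAtℕ toℕ pos-splitsAt (s-beside G<x x<q)
        ; val-increasing = Increasing-updateAtℕ w val-increasing
            (λ i i<a′ → ≤-<-trans (Increasing-≤ val-increasing (below-a′ i<a′) pred-a′<L) (<-trans G<A1 A1<x))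
            (λ j a′<j j<L → <-trans x<A (val-increasing a′ j a′<j j<L))
        ; val-splitsAt = SplitsAt-updateAtℕ w val-splitsAt ((λ a′<a′ → contradiction a′<a′ (n≮n a′)) , λ _ → A1<x)
        }

  A1≤A : A1 ≤ A
  A1≤A = <⇒≤ A1<A

  module PassingThroughA {k : ℕ} (h : Fin k → Fin n) (h-increasing : ∀ i j → i F.< j → h i F.< h j)
    (shifted-decreasing : ∀ i j → i F.< j → shiftVal A A1 (w (h j)) < shiftVal A A1 (w (h i)))
    (t : Fin k) (h-t : h t ≡ q) where

    off-t-≢A : ∀ {i} → i ≢ t → w (h i) ≢ A
    off-t-≢A i≢t eq = i≢t (increasing-injective h-increasing (trans (w-injective eq) (sym h-t)))

    <⇒≢t : ∀ {i} → i F.< t → i ≢ t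
    <⇒≢t i<t refl = n≮n _ i<t

    >⇒≢t : ∀ {j} → t F.< j → j ≢ t
    >⇒≢t t<j refl = n≮n _ t<j

    decreasing-off-t : ∀ i j → i F.< j → i ≢ t → j ≢ t → w (h j) < w (h i)
    decreasing-off-t i j i<j i≢t j≢t =
      shiftVal-reflects-< A1≤A (off-t-≢A j≢t) (off-t-≢A i≢t) (shifted-decreasing i j i<j)

    before-q : ∀ i → i F.< t → toℕ (h i) < toℕ q
    before-q i i<t = subst (λ z → toℕ (h i) < toℕ z) h-t (h-increasing i t i<t)

    after-q : ∀ j → t F.< j → toℕ q < toℕ (h j)
    after-q j t<j = subst (λ z → toℕ z < toℕ (h j)) h-t (h-increasing t j t<j)

    shifted-t : shiftVal A A1 (w (h t)) ≡ A1
    shifted-t rewrite h-t = shiftVal-A A A1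

    A1≤before : ∀ i → i F.< t → A1 ≤ w (h i)
    A1≤before i i<t = shiftVal-A1<⁻ (off-t-≢A (<⇒≢t i<t)) (subst (_< _) shifted-t (shifted-decreasing i t i<t))

    after<A1 : ∀ j → t F.< j → w (h j) < A1
    after<A1 j t<j = shiftVal-<A1⁻ A1≤A (off-t-≢A (>⇒≢t t<j)) (subst (_ <_) shifted-t (shifted-decreasing t j t<j))

    replace-t-by : (z : Fin n) →
      (∀ i → i F.< t → h i F.< z × w z < w (h i)) → (∀ j → t F.< j → z F.< h j × w (h j) < w z) →
      Σ (Fin k → Fin n) (DecreasingSubsequence w)
    replace-t-by z left right = _ , updateAt-decreasing w h t z h-increasing left right decreasing-off-t

    via-s : a′ ≡ 0 → Σ (Fin k → Fin n) (DecreasingSubsequence w)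
    via-s a′≡0 = replace-t-by s left right
      where
      q<s : toℕ q < toℕ s
      q<s = proj₁ (pos-splitsAt a′ a′<L) (≤∧≢⇒< (subst (_≤ p) (sym a′≡0) z≤n) (≢-sym p≢a′))
      left : ∀ i → i F.< t → h i F.< s × A1 < w (h i)
      left i i<t = hi<s , ≤∧≢⇒< (A1≤before i i<t) (λ eq → <⇒≢ hi<s (cong toℕ (sym (w-injective eq))))
        where hi<s = <-trans (before-q i i<t) q<s
      right : ∀ j → t F.< j → s F.< h j × w (h j) < A1
      right j t<j = ⊥-elim (no-smaller-a-1 (h j) (after-q j t<j) (after<A1 j t<j)
                                           (λ i i<a′ → contradiction (subst (i <_) a′≡0 i<a′) λ ()))

    module _ (0<a′ : 0 < a′) where

      after<G : ∀ j → t F.< j → w (h j) < w (G 0<a′)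
      after<G j t<j with <-cmp (w (h j)) (w (G 0<a′))
      ... | tri< lt _ _ = lt
      ... | tri≈ _ eq _ = contradiction (<-trans (G<q 0<a′) (after-q j t<j))
                                        (λ lt → <⇒≢ lt (cong toℕ (sym (w-injective eq))))
      ... | tri> _ _ G<hj = ⊥-elim (no-smaller-a-1 (h j) (after-q j t<j) (after<A1 j t<j)
          λ i i<a′ → ≤-<-trans (Increasing-≤ val-increasing (<⇒≤pred i<a′) (pred-a′<L 0<a′)) G<hj)

      via-q : (∀ i → i F.< t → A < w (h i)) → Σ (Fin k → Fin n) (DecreasingSubsequence w)
      via-q above-A = replace-t-by q (λ i i<t → before-q i i<t , above-A i i<t)
                                     (λ j t<j → after-q j t<j , <-trans (after<A1 j t<j) A1<A)

      via-G : (∀ i → i F.< t → toℕ (h i) < toℕ (G 0<a′)) → Σ (Fin k → Fin n) (DecreasingSubsequence w)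
      via-G before-G = replace-t-by (G 0<a′) (λ i i<t → before-G i i<t , <-≤-trans (G<A1 0<a′) (A1≤before i i<t))
                                             (λ j t<j → <-trans (G<q 0<a′) (after-q j t<j) , after<G j t<j)

      no-entry-between-G-and-q : ∀ i → i F.< t → toℕ (G 0<a′) ≤ toℕ (h i) → w (h i) < A → ⊥
      no-entry-between-G-and-q i i<t G≤hi hi<A =
        no-smaller-a 0<a′ (h i) G<hi (before-q i i<t) A1<hi hi<A
        where
        G<hi : toℕ (G 0<a′) < toℕ (h i)
        G<hi = ≤∧≢⇒< G≤hi λ eq → <⇒≢ (<-≤-trans (G<A1 0<a′) (A1≤before i i<t)) (cong w (FP.toℕ-injective eq))
        A1<hi : A1 < w (h i)
        A1<hi = ≤∧≢⇒< (A1≤before i i<t) λ eq → s-not-beside 0<a′ G<hi (before-q i i<t) (w-injective (sym eq))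

      -- If some entry before t is below A and some is right of G, the later of the two is both.
      via-q-or-G : Σ (Fin k → Fin n) (DecreasingSubsequence w)
      via-q-or-G with FP.any? (λ i → (i FP.<? t) ×-dec (w (h i) <? A))
      ... | no none-below-A =
            via-q λ i i<t → ≤∧≢⇒< (≮⇒≥ λ hi<A → none-below-A (i , i<t , hi<A)) (≢-sym (off-t-≢A (<⇒≢t i<t)))
      ... | yes (i₀ , i₀<t , hi₀<A) with FP.any? (λ i → (i FP.<? t) ×-dec (toℕ (G 0<a′) ≤? toℕ (h i)))
      ...   | no none-right-of-G = via-G λ i i<t → ≰⇒> λ G≤hi → none-right-of-G (i , i<t , G≤hi)
      ...   | yes (i₁ , i₁<t , G≤hi₁) with toℕ i₀ ≤? toℕ i₁
      ...     | yes i₀≤i₁ = ⊥-elim (no-entry-between-G-and-q i₁ i₁<t G≤hi₁ (≤-<-trans hi₁≤hi₀ hi₀<A))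
        where
        hi₁≤hi₀ : w (h i₁) ≤ w (h i₀)
        hi₁≤hi₀ with m≤n⇒m<n∨m≡n i₀≤i₁
        ... | inj₁ i₀<i₁ = <⇒≤ (decreasing-off-t i₀ i₁ i₀<i₁ (<⇒≢t i₀<t) (<⇒≢t i₁<t))
        ... | inj₂ i₀≡i₁ = ≤-reflexive (cong (w ∘ h) (sym (FP.toℕ-injective i₀≡i₁)))
      ...     | no i₀≰i₁ = ⊥-elim (no-entry-between-G-and-q i₀ i₀<t
                                     (<⇒≤ (≤-<-trans G≤hi₁ (h-increasing i₁ i₀ (≰⇒> i₀≰i₁)))) hi₀<A)

    lift : Σ (Fin k → Fin n) (DecreasingSubsequence w)
    lift with a′ ≟ 0
    ... | yes a′≡0 = via-s a′≡0
    ... | no a′≢0 = via-q-or-G (n≢0⇒n>0 a′≢0)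

  decreasing-lift : ∀ {k} (h : Fin k → Fin n) → DecreasingSubsequence (shiftVal A A1 ∘ w) h →
                    Σ (Fin k → Fin n) (DecreasingSubsequence w)
  decreasing-lift h (h-increasing , shifted-decreasing) with FP.any? (λ t → h t FP.≟ q)
  ... | yes (t , h-t) = PassingThroughA.lift h h-increasing shifted-decreasing t h-t
  ... | no q∉h = h , h-increasing , λ i j i<j → shiftVal-reflects-< A1≤A (≢A j) (≢A i) (shifted-decreasing i j i<j)
    where
    ≢A : ∀ i → w (h i) ≢ A
    ≢A i eq = q∉h (i , w-injective eq)

word-injective : ∀ {n} (π : Permutation′ n) {x y : Fin n} → word π x ≡ word π y → x ≡ y
word-injective π = Injection.injective (↔⇒↣ π) ∘ FP.toℕ-injective

Occurrence-≗ : ∀ {n k} {u v : Word n} {ρ : Word k} → (∀ i → u i ≡ v i) → Occurrence u ρ → Occurrence v ρ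
Occurrence-≗ {ρ = ρ} u≗v (f , f-increasing , orderIso) =
  f , f-increasing , λ i j → subst₂ (λ x y → (ρ i < ρ j → x < y) × (x < y → ρ i < ρ j)) (u≗v (f i)) (u≗v (f j)) (orderIso i j)

lemma3p1 : (a b n : ℕ) → 2 ≤ a → (π : Permutation′ n) →
    Avoids (word π) (σ a b) → (m : ℕ) → LongestDecreasing (word π) m →
    (τ : Word n) → IsS a b (word π) τ → Avoids τ (δ (suc m))
lemma3p1 (suc (suc a′)) b n (s≤s (s≤s z≤n)) π _ m (_ , avoids) τ (s-avoid _ τ≗w) occ =
  avoids (Occurrence-≗ τ≗w occ)
lemma3p1 (suc (suc a′)) b n (s≤s (s≤s z≤n)) π _ m (_ , avoids) τ
         (s-move _ _ (_ , A-least) (assocA1 , A1-least) τ≗Sw) occ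
  with AssocA1⇒ΠOccurrence assocA1
... | O , refl , refl = avoids (decreasing⇒δ-occurrence {w = w} _ (proj₂ (decreasing-lift _ (proj₂ shifted-decreasing))))
  where
  w = word π
  open MinimalOccurrence w (word-injective π) O
         (λ O′ → A-least _ (ΠOccurrence⇒PlaysA O′))
         (λ O′ eq → A1-least _ (subst (λ x → AssocA1 _ b w x _) eq (ΠOccurrence⇒AssocA1 O′)))
  shifted-decreasing : Σ (Fin (suc m) → Fin n) (DecreasingSubsequence (shiftVal A A1 ∘ w))
  shifted-decreasing = δ-occurrence⇒decreasing {w = shiftVal A A1 ∘ w} (Occurrence-≗ {v = shiftVal A A1 ∘ w} τ≗Sw occ)
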